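{- For every $\rho<2$ there exists a directed graph $G=(V,E)$ with vertices $s,t$ and unit edge capacities such that no ordering of $E$ is $\rho$-competitive for the incremental maximum $s$-$t$-flow problem; that is, for every ordering there is $k\in\{1,\dots,|E|\}$ with $f(S^{*}_{k})>\rho f(S_{k})$, where $S_{k}$ is the set of the first $k$ edges of the ordering.
   Context: For $X\subseteq E$, $f(X)$ is the maximum value of an $s$-$t$-flow in $(V,X)$ with unit edge capacities; $S^{*}_{k}$ is a set $X\subseteq E$ with $|X|\leq k$ maximizing $f(X)$. An ordering of $E$ is $\rho$-competitive if $f(S^{*}_{k})\leq\rho f(S_{k})$ for all $k$, where $S_k$ is its prefix of the first $k$ edges.
   Formalization: The bound ρ ranges over the rationals, and the flows that define $f(X)$ take rational values. -}

module Defs where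

open import Data.Nat as ℕ using (ℕ; zero; suc)
open import Data.Fin using (Fin; zero; suc; toℕ; _≟_)
open import Data.Fin.Subset using (Subset; _∈_; _∉_; ∣_∣)
open import Data.Fin.Permutation using (Permutation′; _⟨$⟩ˡ_)
open import Data.Bool using (Bool; if_then_else_)
open import Data.Vec using (tabulate)
open import Data.Rational using (ℚ; 0ℚ; 1ℚ; _+_; _-_; _≤_)
open import Data.Product using (Σ; _×_; ∃)
open import Relation.Nullary using (does)
open import Relation.Nullary.Decidable using (⌊_⌋)
open import Relation.Binary.PropositionalEquality using (_≡_; _≢_)

record Digraph : Set where
  field
    n    : ℕ
    m    : ℕ
    tail : Fin m → Fin n
    head : Fin m → Fin n

open Digraph public

-- E ⊆ V × V : no two edges have the same endpoints (no parallel edges).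
Simple : Digraph → Set
Simple G = ∀ e e′ → tail G e ≡ tail G e′ → head G e ≡ head G e′ → e ≡ e′

sumℚ : ∀ {k} → (Fin k → ℚ) → ℚ
sumℚ {zero}  f = 0ℚ
sumℚ {suc k} f = f zero + sumℚ (λ i → f (suc i))

module _ (G : Digraph) where

  inflow : (Fin (m G) → ℚ) → Fin (n G) → ℚ
  inflow φ v = sumℚ (λ e → if does (head G e ≟ v) then φ e else 0ℚ)

  outflow : (Fin (m G) → ℚ) → Fin (n G) → ℚ
  outflow φ v = sumℚ (λ e → if does (tail G e ≟ v) then φ e else 0ℚ)

  -- φ is a feasible s-t-flow in the subgraph (V, X) with unit edge capacities
  -- (edges outside X carry no flow).
  IsFlow : Fin (n G) → Fin (n G) → Subset (m G) → (Fin (m G) → ℚ) → Set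
  IsFlow s t X φ =
    (∀ e → e ∈ X → 0ℚ ≤ φ e × φ e ≤ 1ℚ) ×
    (∀ e → e ∉ X → φ e ≡ 0ℚ) ×
    (∀ v → v ≢ s → v ≢ t → inflow φ v ≡ outflow φ v)

  value : Fin (n G) → (Fin (m G) → ℚ) → ℚ
  value s φ = outflow φ s - inflow φ s

  MaxFlowValue : Fin (n G) → Fin (n G) → Subset (m G) → ℚ → Set
  MaxFlowValue s t X v =
    (∃ λ φ → IsFlow s t X φ × value s φ ≡ v) ×
    (∀ φ → IsFlow s t X φ → value s φ ≤ v)

  IsOptimal : Fin (n G) → Fin (n G) → ℕ → Subset (m G) → ℚ → Set
  IsOptimal s t k X v =
    ∣ X ∣ ℕ.≤ k × MaxFlowValue s t X v ×
    (∀ Y u → ∣ Y ∣ ℕ.≤ k → MaxFlowValue s t Y u → u ≤ v)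

  -- An ordering σ of E lists edge σ(i) at position i (0-based);
  -- S_k is the set of the first k edges of the ordering.
  prefix : Permutation′ (m G) → ℕ → Subset (m G)
  prefix σ k = tabulate (λ e → ⌊ toℕ (σ ⟨$⟩ˡ e) ℕ.<? k ⌋)

-- P = 0→1→2→3 is the only s-t path with at most three edges, so an ordering whose first
-- three edges are not P has f(S₃) = 0 while f(P) = 1. If they are P, every 8 edges
-- containing P still carry a flow of value only 1, whereas the 8 edges other than 1→2
-- form the two disjoint paths 0→1→4→5→3 and 0→6→7→2→3 of total value 2. The upper
-- bounds on flow values are weak duality (a flow is bounded by the capacity of every
-- s-t cut), with the cuts found by exhaustive search over vertex sets.
module Submission where

open import Defs
open import Algebra.Bundles using (CommutativeRing)
open import Data.Bool using (Bool; true; false; _∧_; not; if_then_else_; T)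
open import Data.Bool.Properties using (T-≡)
open import Data.Empty using (⊥-elim)
open import Data.Fin using (Fin; zero; suc; toℕ; _≟_)
open import Data.Fin.Patterns
open import Data.Fin.Permutation as Perm using (Permutation′; _⟨$⟩ˡ_)
open import Data.Fin.Properties using (all?; suc-injective)
open import Data.Fin.Subset using (Subset; _∈_; _∉_; _⊆_; _⊈_; ∣_∣; ⊥)
open import Data.Fin.Subset.Properties using (anySubset?; _∈?_; _⊆?_; ⊆-refl; ⊆-trans; ⊥⊆)
open import Data.Nat as ℕ using (ℕ; zero; suc)
import Data.Nat.Properties as ℕ
open import Data.Product using (Σ; _×_; _,_)
open import Data.Rational as ℚ using (ℚ; 0ℚ; 1ℚ; _+_; _-_; _*_; -_; _≤_; _<_)
import Data.Rational.Properties as ℚ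
open import Data.Vec using (Vec; []; _∷_; tabulate; lookup)
open import Data.Vec.Functional using (replicate)
open import Data.Vec.Properties using (lookup∘tabulate; lookup⇒[]=; []=⇒lookup)
open import Function using (_∘_; case_of_; Equivalence)
open import Relation.Nullary using (Dec; yes; no; does; ¬?; _×-dec_; _→-dec_)
open import Relation.Nullary.Decidable using (⌊_⌋; True; map′; decidable-stable; toWitness; fromWitness; from-yes)
open import Relation.Unary using (Pred; Decidable)
open import Relation.Binary.PropositionalEquality

open import Algebra.Properties.Semiring.Sum (CommutativeRing.semiring ℚ.+-*-commutativeRing)
  using (sum; sum-cong-≗; sum-replicate-zero; ∑-comm; ∑-distrib-+; *-distribˡ-sum)
open import Algebra.Properties.Ring (CommutativeRing.ring ℚ.+-*-commutativeRing)
  using (-1*x≈-x; x[y-z]≈xy-xz; [y-z]x≈yx-zx)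
import Algebra.Properties.CommutativeMonoid.Sum ℕ.+-0-commutativeMonoid as ℕΣ

open ≡-Reasoning

fromℕ : ℕ → ℚ
fromℕ zero    = 0ℚ
fromℕ (suc n) = 1ℚ + fromℕ n

fromℕ-nonneg : ∀ n → 0ℚ ≤ fromℕ n
fromℕ-nonneg zero    = ℚ.≤-refl
fromℕ-nonneg (suc n) = ℚ.+-mono-≤ (ℚ.nonNegative⁻¹ 1ℚ) (fromℕ-nonneg n)

fromℕ-mono-≤ : ∀ {a b} → a ℕ.≤ b → fromℕ a ≤ fromℕ b
fromℕ-mono-≤ {b = b} ℕ.z≤n   = fromℕ-nonneg b
fromℕ-mono-≤ (ℕ.s≤s a≤b)     = ℚ.+-monoʳ-≤ 1ℚ (fromℕ-mono-≤ a≤b)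

𝟙 : Bool → ℚ
𝟙 true  = 1ℚ
𝟙 false = 0ℚ

𝟙ℕ : Bool → ℕ
𝟙ℕ true  = 1
𝟙ℕ false = 0

sumℚ≡sum : ∀ {k} (f : Fin k → ℚ) → sumℚ f ≡ sum f
sumℚ≡sum {zero}  f = refl
sumℚ≡sum {suc k} f = cong (f zero +_) (sumℚ≡sum (f ∘ suc))

sum-single : ∀ {k} (f : Fin k → ℚ) i → (∀ j → j ≢ i → f j ≡ 0ℚ) → sum f ≡ f i
sum-single {suc k} f zero    f≡0 = begin
  f zero + sum (f ∘ suc)            ≡⟨ cong (f zero +_) (sum-cong-≗ λ j → f≡0 (suc j) λ ()) ⟩
  f zero + sum (replicate k 0ℚ)     ≡⟨ cong (f zero +_) (sum-replicate-zero k) ⟩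
  f zero + 0ℚ                       ≡⟨ ℚ.+-identityʳ (f zero) ⟩
  f zero                            ∎
sum-single {suc k} f (suc i) f≡0 = begin
  f zero + sum (f ∘ suc)            ≡⟨ cong₂ _+_ (f≡0 zero λ ()) (sum-single (f ∘ suc) i f∘suc≡0) ⟩
  0ℚ + f (suc i)                    ≡⟨ ℚ.+-identityˡ (f (suc i)) ⟩
  f (suc i)                         ∎
  where
  f∘suc≡0 : ∀ j → j ≢ i → f (suc j) ≡ 0ℚ
  f∘suc≡0 j j≢i = f≡0 (suc j) (j≢i ∘ suc-injective)

sum-distrib-− : ∀ {k} (f g : Fin k → ℚ) → sum (λ i → f i - g i) ≡ sum f - sum g
sum-distrib-− f g = begin
  sum (λ i → f i - g i)             ≡⟨ ∑-distrib-+ f (-_ ∘ g) ⟩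
  sum f + sum (λ i → - g i)         ≡⟨ cong (sum f +_) (sum-cong-≗ λ i → sym (-1*x≈-x (g i))) ⟩
  sum f + sum (λ i → - 1ℚ * g i)    ≡⟨ cong (sum f +_) (sym (*-distribˡ-sum (- 1ℚ) g)) ⟩
  sum f + - 1ℚ * sum g              ≡⟨ cong (sum f +_) (-1*x≈-x (sum g)) ⟩
  sum f - sum g                     ∎

sum-mono-≤ : ∀ {k} {f g : Fin k → ℚ} → (∀ i → f i ≤ g i) → sum f ≤ sum g
sum-mono-≤ {zero}  f≤g = ℚ.≤-refl
sum-mono-≤ {suc k} f≤g = ℚ.+-mono-≤ (f≤g zero) (sum-mono-≤ (f≤g ∘ suc))

sum𝟙≡∣tabulate∣ : ∀ {k} (g : Fin k → Bool) → sum (𝟙 ∘ g) ≡ fromℕ ∣ tabulate g ∣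
sum𝟙≡∣tabulate∣ {zero}  g = refl
sum𝟙≡∣tabulate∣ {suc k} g with g zero
... | true  = cong (1ℚ +_) (sum𝟙≡∣tabulate∣ (g ∘ suc))
... | false = trans (ℚ.+-identityˡ _) (sum𝟙≡∣tabulate∣ (g ∘ suc))

𝟙-difference-bound : ∀ a b c {x} → 0ℚ ≤ x → x ≤ 𝟙 c → (𝟙 a - 𝟙 b) * x ≤ 𝟙 (a ∧ not b ∧ c)
𝟙-difference-bound true  true  c {x} _   _   = ℚ.≤-reflexive (ℚ.*-zeroˡ x)
𝟙-difference-bound true  false c {x} _   x≤c = ℚ.≤-trans (ℚ.≤-reflexive (ℚ.*-identityˡ x)) x≤c
𝟙-difference-bound false true  c {x} 0≤x _   = ℚ.≤-trans (ℚ.≤-reflexive (-1*x≈-x x)) (ℚ.neg-antimono-≤ 0≤x)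
𝟙-difference-bound false false c {x} _   _   = ℚ.≤-reflexive (ℚ.*-zeroˡ x)

sum-incidence : ∀ {m n} (end : Fin m → Fin n) (w : Fin n → ℚ) (φ : Fin m → ℚ) →
  sum (λ v → w v * sumℚ (λ e → if does (end e ≟ v) then φ e else 0ℚ)) ≡ sum (λ e → w (end e) * φ e)
sum-incidence {m} {n} end w φ = begin
  sum (λ v → w v * sumℚ (δ v))         ≡⟨ sum-cong-≗ (λ v → cong (w v *_) (sumℚ≡sum (δ v))) ⟩
  sum (λ v → w v * sum (δ v))          ≡⟨ sum-cong-≗ (λ v → *-distribˡ-sum (w v) (δ v)) ⟩
  sum (λ v → sum (λ e → w v * δ v e))  ≡⟨ ∑-comm (λ v e → w v * δ v e) ⟩
  sum (λ e → sum (λ v → w v * δ v e))  ≡⟨ sum-cong-≗ (λ e → sum-single _ (end e) (off-diagonal e)) ⟩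
  sum (λ e → w (end e) * δ (end e) e)  ≡⟨ sum-cong-≗ (λ e → cong (w (end e) *_) (on-diagonal e)) ⟩
  sum (λ e → w (end e) * φ e)          ∎
  where
  δ : Fin n → Fin m → ℚ
  δ v e = if does (end e ≟ v) then φ e else 0ℚ
  off-diagonal : ∀ e v → v ≢ end e → w v * δ v e ≡ 0ℚ
  off-diagonal e v v≢end with end e ≟ v
  ... | yes end≡v = ⊥-elim (v≢end (sym end≡v))
  ... | no _      = ℚ.*-zeroʳ (w v)
  on-diagonal : ∀ e → δ (end e) e ≡ φ e
  on-diagonal e with end e ≟ end e
  ... | yes _ = refl
  ... | no ≢  = ⊥-elim (≢ refl)

∣tabulate∣≡sum : ∀ {k} (g : Fin k → Bool) → ∣ tabulate g ∣ ≡ ℕΣ.sum (𝟙ℕ ∘ g)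
∣tabulate∣≡sum {zero}  g = refl
∣tabulate∣≡sum {suc k} g with g zero
... | true  = cong suc (∣tabulate∣≡sum (g ∘ suc))
... | false = ∣tabulate∣≡sum (g ∘ suc)

∈-tabulate⁻ : ∀ {k} {f : Fin k → Bool} {x} → x ∈ tabulate f → T (f x)
∈-tabulate⁻ {f = f} {x} x∈ = Equivalence.from T-≡ (trans (sym (lookup∘tabulate f x)) ([]=⇒lookup x∈))

∈-tabulate⁺ : ∀ {k} {f : Fin k → Bool} {x} → T (f x) → x ∈ tabulate f
∈-tabulate⁺ {f = f} {x} Tfx = lookup⇒[]= x (tabulate f) (trans (lookup∘tabulate f x) (Equivalence.to T-≡ Tfx))

allSubsets? : ∀ {k ℓ} {P : Pred (Subset k) ℓ} → Decidable P → Dec (∀ p → P p)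
allSubsets? P? = map′ (λ ¬∃¬P p → decidable-stable (P? p) λ ¬Pp → ¬∃¬P (p , ¬Pp))
                      (λ ∀P (p , ¬Pp) → ¬Pp (∀P p))
                      (¬? (anySubset? (¬? ∘ P?)))

module _ (G : Digraph) where

  crossing : Subset (n G) → Subset (m G) → Subset (m G)
  crossing C X = tabulate λ e → lookup C (tail G e) ∧ not (lookup C (head G e)) ∧ lookup X e

  flow-bounds : ∀ {s t X φ} → IsFlow G s t X φ → ∀ e → 0ℚ ≤ φ e × φ e ≤ 𝟙 (lookup X e)
  flow-bounds {X = X} {φ} (within , outside , _) e with lookup X e in e∈X
  ... | true  = within e (lookup⇒[]= e X e∈X)
  ... | false = ℚ.≤-reflexive (sym φe≡0) , ℚ.≤-reflexive φe≡0
    where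
    φe≡0 : φ e ≡ 0ℚ
    φe≡0 = outside e λ e∈X′ → case trans (sym ([]=⇒lookup e∈X′)) e∈X of λ ()

  net : (Fin (m G) → ℚ) → Fin (n G) → ℚ
  net φ v = outflow G φ v - inflow G φ v

  value≡sum-net : ∀ {s t X φ C} → IsFlow G s t X φ → s ∈ C → t ∉ C →
    value G s φ ≡ sum (λ v → 𝟙 (lookup C v) * net φ v)
  value≡sum-net {s} {t} {φ = φ} {C} (_ , _ , conserve) s∈C t∉C = sym (begin
    sum (λ v → 𝟙 (lookup C v) * net φ v)  ≡⟨ sum-single _ s vanishes ⟩
    𝟙 (lookup C s) * net φ s              ≡⟨ cong (λ b → 𝟙 b * net φ s) ([]=⇒lookup s∈C) ⟩
    1ℚ * net φ s                          ≡⟨ ℚ.*-identityˡ (net φ s) ⟩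
    net φ s                               ∎)
    where
    vanishes : ∀ v → v ≢ s → 𝟙 (lookup C v) * net φ v ≡ 0ℚ
    vanishes v v≢s with lookup C v in v∈C
    ... | false = ℚ.*-zeroˡ (net φ v)
    ... | true  = begin
      1ℚ * net φ v                          ≡⟨ ℚ.*-identityˡ (net φ v) ⟩
      outflow G φ v - inflow G φ v          ≡⟨ cong (λ x → outflow G φ v - x) (conserve v v≢s v≢t) ⟩
      outflow G φ v - outflow G φ v         ≡⟨ ℚ.+-inverseʳ (outflow G φ v) ⟩
      0ℚ                                    ∎
      where
      v≢t : v ≢ t
      v≢t refl = t∉C (lookup⇒[]= v C v∈C)

  sum-net≡sum-edges : ∀ φ C → sum (λ v → 𝟙 (lookup C v) * net φ v)
    ≡ sum (λ e → (𝟙 (lookup C (tail G e)) - 𝟙 (lookup C (head G e))) * φ e)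
  sum-net≡sum-edges φ C = begin
    sum (λ v → w v * net φ v)                      ≡⟨ sum-cong-≗ (λ v → x[y-z]≈xy-xz (w v) (outflow G φ v) (inflow G φ v)) ⟩
    sum (λ v → wout v - win v)                     ≡⟨ sum-distrib-− wout win ⟩
    sum wout - sum win                             ≡⟨ cong₂ _-_ (sum-incidence (tail G) w φ) (sum-incidence (head G) w φ) ⟩
    sum w-tail - sum w-head                        ≡⟨ sum-distrib-− w-tail w-head ⟨
    sum (λ e → w-tail e - w-head e)                ≡⟨ sum-cong-≗ (λ e → [y-z]x≈yx-zx (φ e) (w (tail G e)) (w (head G e))) ⟨
    sum (λ e → (w (tail G e) - w (head G e)) * φ e) ∎
    where
    w wout win : Fin (n G) → ℚ
    w = 𝟙 ∘ lookup C
    wout v = w v * outflow G φ v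
    win v = w v * inflow G φ v
    w-tail w-head : Fin (m G) → ℚ
    w-tail e = w (tail G e) * φ e
    w-head e = w (head G e) * φ e

  value≤capacity : ∀ {s t X φ C} → IsFlow G s t X φ → s ∈ C → t ∉ C → value G s φ ≤ fromℕ ∣ crossing C X ∣
  value≤capacity {X = X} {φ} {C} isFlow s∈C t∉C =
    subst₂ _≤_ (sym (trans (value≡sum-net isFlow s∈C t∉C) (sum-net≡sum-edges φ C)))
               (sum𝟙≡∣tabulate∣ (λ e → lookup C (tail G e) ∧ not (lookup C (head G e)) ∧ lookup X e))
               (sum-mono-≤ edgewise)
    where
    edgewise : ∀ e → (𝟙 (lookup C (tail G e)) - 𝟙 (lookup C (head G e))) * φ e
                     ≤ 𝟙 (lookup C (tail G e) ∧ not (lookup C (head G e)) ∧ lookup X e)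
    edgewise e = let 0≤φe , φe≤1 = flow-bounds isFlow e in
      𝟙-difference-bound (lookup C (tail G e)) (lookup C (head G e)) (lookup X e) 0≤φe φe≤1

  record CutOfCapacity≤ (s t : Fin (n G)) (X : Subset (m G)) (b : ℕ) : Set where
    constructor cut
    field
      side      : Subset (n G)
      s∈side    : s ∈ side
      t∉side    : t ∉ side
      capacity≤ : ∣ crossing side X ∣ ℕ.≤ b

  cutOfCapacity≤? : ∀ s t X b → Dec (CutOfCapacity≤ s t X b)
  cutOfCapacity≤? s t X b =
    map′ (λ { (C , s∈C , t∉C , capacity≤b) → cut C s∈C t∉C capacity≤b })
         (λ { (cut C s∈C t∉C capacity≤b) → C , s∈C , t∉C , capacity≤b })
         (anySubset? λ C → s ∈? C ×-dec ¬? (t ∈? C) ×-dec ∣ crossing C X ∣ ℕ.≤? b)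

  cut-weaken : ∀ {s t X b b′} → b ℕ.≤ b′ → CutOfCapacity≤ s t X b → CutOfCapacity≤ s t X b′
  cut-weaken b≤b′ (cut C s∈C t∉C capacity≤b) = cut C s∈C t∉C (ℕ.≤-trans capacity≤b b≤b′)

  value≤ : ∀ {s t X b φ} → CutOfCapacity≤ s t X b → IsFlow G s t X φ → value G s φ ≤ fromℕ b
  value≤ (cut C s∈C t∉C capacity≤b) isFlow =
    ℚ.≤-trans (value≤capacity isFlow s∈C t∉C) (fromℕ-mono-≤ capacity≤b)

  maxFlowValue : ∀ {s t X b φ} → IsFlow G s t X φ → value G s φ ≡ fromℕ b → CutOfCapacity≤ s t X b →
    MaxFlowValue G s t X (fromℕ b)
  maxFlowValue isFlow value≡b C = (_ , isFlow , value≡b) , λ _ → value≤ C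

  maxFlowValue≤ : ∀ {s t X b u} → MaxFlowValue G s t X u → CutOfCapacity≤ s t X b → u ≤ fromℕ b
  maxFlowValue≤ ((φ , isFlow , refl) , _) C = value≤ C isFlow

  isOptimal : ∀ {s t X k b} → ∣ X ∣ ℕ.≤ k → MaxFlowValue G s t X (fromℕ b) →
    (∀ Y → ∣ Y ∣ ℕ.≤ k → CutOfCapacity≤ s t Y b) → IsOptimal G s t k X (fromℕ b)
  isOptimal ∣X∣≤k maxX cuts = ∣X∣≤k , maxX , λ Y u ∣Y∣≤k maxY → maxFlowValue≤ maxY (cuts Y ∣Y∣≤k)

  Conserving : Fin (n G) → Fin (n G) → (Fin (m G) → ℚ) → Set
  Conserving s t φ = ∀ v → v ≢ s → v ≢ t → inflow G φ v ≡ outflow G φ v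

  conserving? : ∀ s t φ → Dec (Conserving s t φ)
  conserving? s t φ = all? λ v → ¬? (v ≟ s) →-dec ¬? (v ≟ t) →-dec inflow G φ v ℚ.≟ outflow G φ v

  indicator-isFlow : ∀ {s t X p} → p ⊆ X → Conserving s t (𝟙 ∘ lookup p) → IsFlow G s t X (𝟙 ∘ lookup p)
  indicator-isFlow {X = X} {p} p⊆X conserving = (λ e _ → 𝟙-bounds (lookup p e)) , outside , conserving
    where
    𝟙-bounds : ∀ b → 0ℚ ≤ 𝟙 b × 𝟙 b ≤ 1ℚ
    𝟙-bounds true  = ℚ.nonNegative⁻¹ 1ℚ , ℚ.≤-refl
    𝟙-bounds false = ℚ.≤-refl , ℚ.nonNegative⁻¹ 1ℚ
    outside : ∀ e → e ∉ X → 𝟙 (lookup p e) ≡ 0ℚ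
    outside e e∉X with lookup p e in e∈p
    ... | true  = ⊥-elim (e∉X (p⊆X (lookup⇒[]= e p e∈p)))
    ... | false = refl

  simple? : Dec (Simple G)
  simple? = all? λ e → all? λ e′ → tail G e ≟ tail G e′ →-dec head G e ≟ head G e′ →-dec e ≟ e′

  prefix-mono : ∀ σ {j k} → j ℕ.≤ k → prefix G σ j ⊆ prefix G σ k
  prefix-mono σ j≤k x∈Sj = ∈-tabulate⁺ (fromWitness (ℕ.<-≤-trans (toWitness (∈-tabulate⁻ x∈Sj)) j≤k))

  ∣prefix∣-invariant : ∀ σ k → ∣ prefix G σ k ∣ ≡ ∣ prefix G Perm.id k ∣
  ∣prefix∣-invariant σ k = begin
    ∣ prefix G σ k ∣                ≡⟨ ∣tabulate∣≡sum (before ∘ (σ ⟨$⟩ˡ_)) ⟩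
    ℕΣ.sum (𝟙ℕ ∘ before ∘ (σ ⟨$⟩ˡ_)) ≡⟨ ℕΣ.∑-permute (𝟙ℕ ∘ before) (Perm.flip σ) ⟨
    ℕΣ.sum (𝟙ℕ ∘ before)            ≡⟨ ∣tabulate∣≡sum before ⟨
    ∣ prefix G Perm.id k ∣          ∎
    where
    before : Fin (m G) → Bool
    before i = ⌊ toℕ i ℕ.<? k ⌋

gadget : Digraph
gadget = record { n = 8 ; m = 9 ; tail = lookup tails ; head = lookup heads }
  where
  tails heads : Vec (Fin 8) 9
  tails = 0F ∷ 1F ∷ 2F ∷ 1F ∷ 4F ∷ 5F ∷ 0F ∷ 6F ∷ 7F ∷ []
  heads = 1F ∷ 2F ∷ 3F ∷ 4F ∷ 5F ∷ 3F ∷ 6F ∷ 7F ∷ 2F ∷ []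

s t : Fin 8
s = 0F
t = 3F

-- P is the path 0→1→2→3 and Q consists of all edges except 1→2.
P Q : Subset 9
P = true ∷ true ∷ true ∷ false ∷ false ∷ false ∷ false ∷ false ∷ false ∷ []
Q = true ∷ false ∷ true ∷ true ∷ true ∷ true ∷ true ∷ true ∷ true ∷ []

small-P-free-sets-have-cut≤0 : ∀ X → ∣ X ∣ ℕ.≤ 3 → P ⊈ X → CutOfCapacity≤ gadget s t X 0
small-P-free-sets-have-cut≤0 = from-yes (allSubsets? λ X →
  ∣ X ∣ ℕ.≤? 3 →-dec ¬? (P ⊆? X) →-dec cutOfCapacity≤? gadget s t X 0)

P-containing-sets-have-cut≤1 : ∀ X → ∣ X ∣ ℕ.≤ 8 → P ⊆ X → CutOfCapacity≤ gadget s t X 1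
P-containing-sets-have-cut≤1 = from-yes (allSubsets? λ X →
  ∣ X ∣ ℕ.≤? 8 →-dec P ⊆? X →-dec cutOfCapacity≤? gadget s t X 1)

all-sets-have-cut≤2 : ∀ X → CutOfCapacity≤ gadget s t X 2
all-sets-have-cut≤2 = from-yes (allSubsets? λ X → cutOfCapacity≤? gadget s t X 2)

small-sets-have-cut≤1 : ∀ X → ∣ X ∣ ℕ.≤ 3 → CutOfCapacity≤ gadget s t X 1
small-sets-have-cut≤1 X ∣X∣≤3 with P ⊆? X
... | yes P⊆X = P-containing-sets-have-cut≤1 X (ℕ.≤-trans ∣X∣≤3 (ℕ.m≤m+n 3 5)) P⊆X
... | no  P⊈X = cut-weaken gadget ℕ.z≤n (small-P-free-sets-have-cut≤0 X ∣X∣≤3 P⊈X)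

indicator-isFlow-in-gadget : ∀ p {X} → p ⊆ X → True (conserving? gadget s t (𝟙 ∘ lookup p)) →
  IsFlow gadget s t X (𝟙 ∘ lookup p)
indicator-isFlow-in-gadget p p⊆X conserving = indicator-isFlow gadget p⊆X (toWitness conserving)

P-optimal : IsOptimal gadget s t 3 P (fromℕ 1)
P-optimal = isOptimal gadget ℕ.≤-refl
  (maxFlowValue gadget (indicator-isFlow-in-gadget P ⊆-refl _) refl (small-sets-have-cut≤1 P ℕ.≤-refl))
  small-sets-have-cut≤1

Q-optimal : IsOptimal gadget s t 8 Q (fromℕ 2)
Q-optimal = isOptimal gadget ℕ.≤-refl
  (maxFlowValue gadget (indicator-isFlow-in-gadget Q ⊆-refl _) refl (all-sets-have-cut≤2 Q))
  (λ Y _ → all-sets-have-cut≤2 Y)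

prefixes-lose-factor-2 : ∀ {ρ} → ρ < 1ℚ + 1ℚ → (σ : Permutation′ 9) →
  Σ ℕ λ k → 1 ℕ.≤ k × k ℕ.≤ 9 × Σ (Subset 9) λ X → Σ ℚ λ v → Σ ℚ λ w →
    IsOptimal gadget s t k X v × MaxFlowValue gadget s t (prefix gadget σ k) w × ρ * w < v
prefixes-lose-factor-2 {ρ} ρ<2 σ with P ⊆? prefix gadget σ 3
... | no P⊈S₃ = 3 , ℕ.s≤s ℕ.z≤n , ℕ.m≤m+n 3 6 , P , fromℕ 1 , fromℕ 0 , P-optimal , S₃-max-flow ,
  subst (_< 1ℚ) (sym (ℚ.*-zeroʳ ρ)) (ℚ.positive⁻¹ 1ℚ)
  where
  S₃-max-flow : MaxFlowValue gadget s t (prefix gadget σ 3) (fromℕ 0)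
  S₃-max-flow = maxFlowValue gadget (indicator-isFlow-in-gadget ⊥ ⊥⊆ _) refl
    (small-P-free-sets-have-cut≤0 _ (ℕ.≤-reflexive (∣prefix∣-invariant gadget σ 3)) P⊈S₃)
... | yes P⊆S₃ = 8 , ℕ.s≤s ℕ.z≤n , ℕ.n≤1+n 8 , Q , fromℕ 2 , fromℕ 1 , Q-optimal , S₈-max-flow ,
  subst (_< fromℕ 2) (sym (ℚ.*-identityʳ ρ)) ρ<2
  where
  P⊆S₈ : P ⊆ prefix gadget σ 8
  P⊆S₈ = ⊆-trans P⊆S₃ (prefix-mono gadget σ (ℕ.m≤m+n 3 5))
  S₈-max-flow : MaxFlowValue gadget s t (prefix gadget σ 8) (fromℕ 1)
  S₈-max-flow = maxFlowValue gadget (indicator-isFlow-in-gadget P P⊆S₈ _) refl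
    (P-containing-sets-have-cut≤1 _ (ℕ.≤-reflexive (∣prefix∣-invariant gadget σ 8)) P⊆S₈)

theorem5 : (ρ : ℚ) → ρ < 1ℚ + 1ℚ →
    Σ Digraph λ G → Simple G × Σ (Fin (n G)) λ s → Σ (Fin (n G)) λ t → s ≢ t ×
      ((σ : Permutation′ (m G)) →
        Σ ℕ λ k → 1 ℕ.≤ k × k ℕ.≤ m G ×
          Σ (Subset (m G)) λ X → Σ ℚ λ v → Σ ℚ λ w →
            IsOptimal G s t k X v × MaxFlowValue G s t (prefix G σ k) w × ρ * w < v)
theorem5 ρ ρ<2 = gadget , from-yes (simple? gadget) , s , t , (λ ()) , prefixes-lose-factor-2 ρ<2
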